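{- Let $P$ and $V$ be monads on $\mathbf{Set}$ presented by algebraic theories $\mathbb{P}$ and $\mathbb{V}$, with $\mathbb{P}$ consistent, and suppose there are a stable universal set $T_{\mathbb{P}}$ of $\mathbb{P}$-terms, a stable universal set $T_{\mathbb{V}}$ of $\mathbb{V}$-terms, and terms $2 \vdash_{\mathbb{P}} p$, $2 \vdash_{\mathbb{V}} v$ such that: $p(1,2) =_{\mathbb{P}} p(2,1)$; $p(1,1) =_{\mathbb{P}} 1$; every $p' \in T_{\mathbb{P}}$ with $p(1,2) =_{\mathbb{P}} p'$ satisfies $2 \vdash p'$; $v(1,1) =_{\mathbb{V}} 1$; for every $v' \in T_{\mathbb{V}}$ and variable $x$, if $x =_{\mathbb{V}} v'$ then $\{x\} \vdash v'$; and for every $v' \in T_{\mathbb{V}}$, if $v(1,2) =_{\mathbb{V}} v'$ then neither $\{1\}\vdash v'$ nor $\{2\} \vdash v'$. Then there is no distributive law of type $V \circ P \Rightarrow P \circ V$.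
   Context: A monad on $\mathbf{Set}$ is $\langle T,\eta,\mu\rangle$ with $T$ an endofunctor and natural transformations $\eta:1\Rightarrow T$, $\mu:TT\Rightarrow T$ satisfying $\mu\cdot T\eta=\mathrm{id}=\mu\cdot\eta T$ and $\mu\cdot T\mu=\mu\cdot\mu T$. For monads $S,T$, a distributive law of type $S\circ T\Rightarrow T\circ S$ is a natural transformation $\lambda:ST\Rightarrow TS$ with $\lambda\cdot\eta^S T=T\eta^S$, $\lambda\cdot S\eta^T=\eta^T S$, $\lambda\cdot\mu^S T=T\mu^S\cdot\lambda S\cdot S\lambda$, $\lambda\cdot S\mu^T=\mu^T S\cdot T\lambda\cdot\lambda T$. An algebraic theory (signature plus equations; $=_{\mathbb T}$ is provable equality) presents a monad if the monad is isomorphic to its free model monad, sending $X$ to the set of terms over $X$ modulo provable equality, with unit the inclusion of variables and multiplication flattening terms of terms. Variables are natural numbers, $n$ also denotes $\{1,\dots,n\}$, $Y\vdash t$ means all variables of $t$ lie in $Y$, and $p(a,b)$ means substituting $a$ for $1$, $b$ for $2$. A theory is consistent if it does not prove $x=y$ for distinct variables. A set of terms is universal if every term is provably equal to one of its members, and stable if closed under substituting variables for variables. -}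

module Defs where

open import Data.Nat using (ℕ)
open import Data.Fin using (Fin)
open import Data.Product using (Σ; ∃; _×_; _,_)
open import Data.Empty using (⊥)
open import Data.Sum using (_⊎_)
open import Relation.Nullary using (¬_)
open import Relation.Binary.PropositionalEquality using (_≡_)
open import Function using (_∘_; id)

record Monad : Set₁ where
  field
    F     : Set → Set
    fmap  : {X Y : Set} → (X → Y) → F X → F Y
    η     : {X : Set} → X → F X
    μ     : {X : Set} → F (F X) → F X
    fmap-id   : {X : Set} (a : F X) → fmap id a ≡ a
    fmap-∘    : {X Y Z : Set} (g : Y → Z) (f : X → Y) (a : F X) →
                fmap (g ∘ f) a ≡ fmap g (fmap f a)
    η-nat     : {X Y : Set} (f : X → Y) (x : X) → fmap f (η x) ≡ η (f x)
    μ-nat     : {X Y : Set} (f : X → Y) (a : F (F X)) →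
                fmap f (μ a) ≡ μ (fmap (fmap f) a)
    μ-Fη      : {X : Set} (a : F X) → μ (fmap η a) ≡ a
    μ-ηF      : {X : Set} (a : F X) → μ (η a) ≡ a
    μ-assoc   : {X : Set} (a : F (F (F X))) → μ (fmap μ a) ≡ μ (μ a)

record DistributiveLaw (S T : Monad) : Set₁ where
  module S = Monad S
  module T = Monad T
  field
    λ′     : {X : Set} → S.F (T.F X) → T.F (S.F X)
    natural : {X Y : Set} (f : X → Y) (a : S.F (T.F X)) →
              T.fmap (S.fmap f) (λ′ a) ≡ λ′ (S.fmap (T.fmap f) a)
    unitS  : {X : Set} (a : T.F X) → λ′ (S.η a) ≡ T.fmap S.η a
    unitT  : {X : Set} (a : S.F X) → λ′ (S.fmap T.η a) ≡ T.η a
    multS  : {X : Set} (a : S.F (S.F (T.F X))) →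
             λ′ (S.μ a) ≡ T.fmap S.μ (λ′ (S.fmap λ′ a))
    multT  : {X : Set} (a : S.F (T.F (T.F X))) →
             λ′ (S.fmap T.μ a) ≡ T.μ (T.fmap λ′ (λ′ a))

record Signature : Set₁ where
  field
    Op    : Set
    arity : Op → ℕ

module _ (Σ′ : Signature) where
  open Signature Σ′

  data Term (X : Set) : Set where
    var : X → Term X
    op  : (o : Op) → (Fin (arity o) → Term X) → Term X

module _ {Σ′ : Signature} where
  open Signature Σ′

  infixl 30 _[_]
  _[_] : {X Y : Set} → Term Σ′ X → (X → Term Σ′ Y) → Term Σ′ Y
  var x  [ σ ] = σ x
  op o ts [ σ ] = op o (λ i → ts i [ σ ])

  rename : {X Y : Set} → (X → Y) → Term Σ′ X → Term Σ′ Y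
  rename f t = t [ (λ x → var (f x)) ]

  join : {X : Set} → Term Σ′ (Term Σ′ X) → Term Σ′ X
  join t = t [ id ]

  _⊢ᵥ_ : {X : Set} → (X → Set) → Term Σ′ X → Set
  Y ⊢ᵥ var x   = Y x
  Y ⊢ᵥ op o ts = (i : Fin (arity o)) → Y ⊢ᵥ ts i

record Theory : Set₁ where
  field
    sig : Signature
    Eqn : Set
    lhs rhs : Eqn → Term sig ℕ
  open Signature sig public

infix 4 _⊢_≈_
data _⊢_≈_ (𝕋 : Theory) {X : Set} : Term (Theory.sig 𝕋) X → Term (Theory.sig 𝕋) X → Set where
  ≈-refl  : {t : Term (Theory.sig 𝕋) X} → 𝕋 ⊢ t ≈ t
  ≈-sym   : {s t : Term (Theory.sig 𝕋) X} → 𝕋 ⊢ s ≈ t → 𝕋 ⊢ t ≈ s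
  ≈-trans : {s t u : Term (Theory.sig 𝕋) X} → 𝕋 ⊢ s ≈ t → 𝕋 ⊢ t ≈ u → 𝕋 ⊢ s ≈ u
  ≈-cong  : (o : Theory.Op 𝕋) {ss ts : Fin (Theory.arity 𝕋 o) → Term (Theory.sig 𝕋) X} →
            ((i : Fin (Theory.arity 𝕋 o)) → 𝕋 ⊢ ss i ≈ ts i) →
            𝕋 ⊢ op o ss ≈ op o ts
  ≈-axiom : (e : Theory.Eqn 𝕋) (σ : ℕ → Term (Theory.sig 𝕋) X) →
            𝕋 ⊢ Theory.lhs 𝕋 e [ σ ] ≈ Theory.rhs 𝕋 e [ σ ]

module _ (𝕋 : Theory) where
  open Theory 𝕋

  Consistent : Set
  Consistent = (x y : ℕ) → 𝕋 ⊢ var x ≈ var y → x ≡ y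

  Universal : (Term sig ℕ → Set) → Set
  Universal U = (t : Term sig ℕ) → Σ (Term sig ℕ) (λ t′ → U t′ × 𝕋 ⊢ t ≈ t′)

  Stable : (Term sig ℕ → Set) → Set
  Stable U = (f : ℕ → ℕ) (t : Term sig ℕ) → U t → U (rename f t)

  -- The monad M is presented by 𝕋: M is isomorphic (as a monad) to the free
  -- model monad X ↦ Term X / provable equality.  Since Agda has no quotient
  -- types, the isomorphism is given as a family of maps  q : Term X → M X
  -- which are surjective with kernel exactly provable equality (so M X is the
  -- quotient), natural, and which send variables to the unit and flattening
  -- of terms of terms to the multiplication.
  record Presents (M : Monad) : Set₁ where
    open Monad M
    field
      q          : {X : Set} → Term sig X → F X
      q-surj     : {X : Set} (a : F X) → ∃ λ t → q t ≡ a
      q-sound    : {X : Set} {s t : Term sig X} → 𝕋 ⊢ s ≈ t → q s ≡ q t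
      q-complete : {X : Set} {s t : Term sig X} → q s ≡ q t → 𝕋 ⊢ s ≈ t
      q-nat      : {X Y : Set} (f : X → Y) (t : Term sig X) →
                   fmap f (q t) ≡ q (rename f t)
      q-η        : {X : Set} (x : X) → η x ≡ q (var x)
      q-μ        : {X : Set} (t : Term sig (Term sig X)) →
                   μ (q (rename q t)) ≡ q (join t)

In12 : ℕ → Set
In12 n = (n ≡ 1) ⊎ (n ≡ 2)

Only : ℕ → ℕ → Set
Only x n = n ≡ x

pair : {Σ′ : Signature} → Term Σ′ ℕ → Term Σ′ ℕ → ℕ → Term Σ′ ℕ
pair a b 1 = a
pair a b 2 = b
pair a b n = var n

infixl 30 _⟨_,_⟩
_⟨_,_⟩ : {Σ′ : Signature} → Term Σ′ ℕ → ℕ → ℕ → Term Σ′ ℕ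
p ⟨ a , b ⟩ = p [ pair (var a) (var b) ]

-- Let φ send 1 to p(1,2) and 2 to p(3,4), and let ℓ = λ(v(φ1, φ2)) ∈ P V ℕ.  By naturality of λ,
-- gluing (3,4) onto (1,2) or onto (2,1) sends ℓ to p(η1, η2) (p is commutative, v idempotent),
-- while squashing 1, 2 to 1 and 3, 4 to 2 sends it to η(v(1,2)) (p is idempotent).  Label each
-- element b ∈ V ℕ of a P-term for ℓ by its two glued images (η1, η2 or other) and by whether its
-- squashed image is v(1,2); the three equations transfer to the labelled term.  In a normal form
-- of it both glued components of every label lie in {1,2}, so the squashed image of b is a V-term
-- in a single variable and differs from v(1,2): the squashed equation collapses onto a single
-- variable, contradicting consistency.  Equality on V ℕ is undecidable, so the labelling exists
-- only under double negation, which suffices for proving ⊥.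
module Submission where

open import Defs
open import Data.Bool using (true; false; if_then_else_)
open import Data.Empty using (⊥; ⊥-elim)
open import Data.Fin using (Fin; zero; suc)
open import Data.Nat using (ℕ; zero; suc; _+_; _*_; _<_; _≤_; _⊔_; _≟_; _≡ᵇ_; s≤s; z≤n)
open import Data.Nat.DivMod using (_%_; _/_; [m+kn]%n≡m%n; m<n⇒m%n≡m; +-distrib-/-∣ʳ; m<n⇒m/n≡0; m*n/n≡m)
open import Data.Nat.Divisibility using (n∣m*n)
open import Data.Nat.Properties using (≤-trans; ≤-refl; m≤m⊔n; m≤n⊔m; ≤∧≢⇒<)
open import Data.Product using (Σ; ∃; _×_; _,_; proj₁; proj₂)
open import Data.Sum using (_⊎_; inj₁; inj₂)
open import Effect.Monad using (RawMonad)
open import Function using (_∘_; id)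
open import Level using (0ℓ)
open import Relation.Binary.PropositionalEquality using (_≡_; _≢_; refl; sym; trans; cong; cong₂; subst)
open import Relation.Nullary using (¬_; yes; no)
open import Relation.Nullary.Decidable using (¬¬-excluded-middle)
open import Relation.Nullary.Negation using (¬¬-Monad)

open RawMonad (¬¬-Monad {a = 0ℓ})

¬¬-Π-Fin : ∀ n {A : Fin n → Set} → (∀ i → ¬ ¬ A i) → ¬ ¬ (∀ i → A i)
¬¬-Π-Fin zero    h = pure λ ()
¬¬-Π-Fin (suc n) h = do
  a  ← h zero
  as ← ¬¬-Π-Fin n (h ∘ suc)
  pure λ { zero → a ; (suc i) → as i }

¬¬-choice-< : ∀ n {A : Set} {R : ℕ → A → Set} → A → (∀ j → ¬ ¬ Σ A (R j)) →
              ¬ ¬ Σ (ℕ → A) (λ f → ∀ j → j < n → R j (f j))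
¬¬-choice-< zero    a₀ h = pure ((λ _ → a₀) , λ _ ())
¬¬-choice-< (suc n) {A} {R} a₀ h = do
  (f , f-ok) ← ¬¬-choice-< n a₀ h
  (a , a-ok) ← h n
  pure (extend f a , extend-ok f-ok a-ok)
  where
  extend : (ℕ → A) → A → ℕ → A
  extend f a j with j ≟ n
  ... | yes _ = a
  ... | no  _ = f j

  extend-ok : ∀ {f a} → (∀ j → j < n → R j (f j)) → R n a →
              ∀ j → j < suc n → R j (extend f a j)
  extend-ok f-ok a-ok j (s≤s j≤n) with j ≟ n
  ... | yes refl = a-ok
  ... | no  j≢n  = f-ok j (≤∧≢⇒< j≤n j≢n)

module _ {Σ′ : Signature} where
  open Signature Σ′

  ⊢ᵥ-mono : {X : Set} {A B : X → Set} → (∀ {x} → A x → B x) →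
            (t : Term Σ′ X) → A ⊢ᵥ t → B ⊢ᵥ t
  ⊢ᵥ-mono A⊆B (var x)   a = A⊆B a
  ⊢ᵥ-mono A⊆B (op o ts) a = λ i → ⊢ᵥ-mono A⊆B (ts i) (a i)

  ⊢ᵥ-[] : {X Y : Set} {A : X → Set} {B : Y → Set} (t : Term Σ′ X) {σ : X → Term Σ′ Y} →
          A ⊢ᵥ t → (∀ x → A x → B ⊢ᵥ σ x) → B ⊢ᵥ t [ σ ]
  ⊢ᵥ-[] (var x)   a h = h x a
  ⊢ᵥ-[] (op o ts) a h = λ i → ⊢ᵥ-[] (ts i) (a i) h

  ⊢ᵥ-rename⁻ : {X Y : Set} {B : Y → Set} (t : Term Σ′ X) {f : X → Y} →
               B ⊢ᵥ rename f t → (B ∘ f) ⊢ᵥ t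
  ⊢ᵥ-rename⁻ (var x)   b = b
  ⊢ᵥ-rename⁻ (op o ts) b = λ i → ⊢ᵥ-rename⁻ (ts i) (b i)

  ⊢ᵥ-× : {X : Set} {A B : X → Set} (t : Term Σ′ X) →
         A ⊢ᵥ t → B ⊢ᵥ t → (λ x → A x × B x) ⊢ᵥ t
  ⊢ᵥ-× (var x)   a b = a , b
  ⊢ᵥ-× (op o ts) a b = λ i → ⊢ᵥ-× (ts i) (a i) (b i)

  ⊢ᵥ-⟨1,2⟩ : (t : Term Σ′ ℕ) → In12 ⊢ᵥ t → In12 ⊢ᵥ t ⟨ 1 , 2 ⟩
  ⊢ᵥ-⟨1,2⟩ t t-binary = ⊢ᵥ-[] t t-binary λ { _ (inj₁ refl) → inj₁ refl ; _ (inj₂ refl) → inj₂ refl }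

  Fin-bounded : ∀ n (b : Fin n → ℕ) → ∃ λ B → ∀ i → b i ≤ B
  Fin-bounded zero    b = 0 , λ ()
  Fin-bounded (suc n) b with Fin-bounded n (b ∘ suc)
  ... | B , b≤B = b zero ⊔ B , λ { zero    → m≤m⊔n (b zero) B
                                  ; (suc i) → ≤-trans (b≤B i) (m≤n⊔m (b zero) B) }

  bounded : (t : Term Σ′ ℕ) → ∃ λ B → (_< B) ⊢ᵥ t
  bounded (var x)   = suc x , ≤-refl
  bounded (op o ts) with Fin-bounded (arity o) (proj₁ ∘ bounded ∘ ts)
  ... | B , b≤B = B , λ i → ⊢ᵥ-mono (λ j< → ≤-trans j< (b≤B i)) (ts i) (proj₂ (bounded (ts i)))

module Equational (𝕋 : Theory) where
  open Theory 𝕋 using (sig; lhs; rhs)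

  infixr 5 _∙_
  _∙_ : {X : Set} {s t u : Term sig X} → 𝕋 ⊢ s ≈ t → 𝕋 ⊢ t ≈ u → 𝕋 ⊢ s ≈ u
  _∙_ = ≈-trans

  ≡⇒≈ : {X : Set} {s t : Term sig X} → s ≡ t → 𝕋 ⊢ s ≈ t
  ≡⇒≈ refl = ≈-refl

  []-congʳ : {X Y : Set} {A : X → Set} (t : Term sig X) {σ σ′ : X → Term sig Y} →
             A ⊢ᵥ t → (∀ x → A x → 𝕋 ⊢ σ x ≈ σ′ x) → 𝕋 ⊢ t [ σ ] ≈ t [ σ′ ]
  []-congʳ (var x)   a h = h x a
  []-congʳ (op o ts) a h = ≈-cong o λ i → []-congʳ (ts i) (a i) h

  []-assoc : {X Y Z : Set} (t : Term sig X) (σ : X → Term sig Y) (τ : Y → Term sig Z) →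
             𝕋 ⊢ t [ σ ] [ τ ] ≈ t [ (λ x → σ x [ τ ]) ]
  []-assoc (var x)   σ τ = ≈-refl
  []-assoc (op o ts) σ τ = ≈-cong o λ i → []-assoc (ts i) σ τ

  []-identity : {X : Set} (t : Term sig X) → 𝕋 ⊢ t [ var ] ≈ t
  []-identity (var x)   = ≈-refl
  []-identity (op o ts) = ≈-cong o λ i → []-identity (ts i)

  []-congˡ : {X Y : Set} {s t : Term sig X} → 𝕋 ⊢ s ≈ t → (τ : X → Term sig Y) →
             𝕋 ⊢ s [ τ ] ≈ t [ τ ]
  []-congˡ ≈-refl          τ = ≈-refl
  []-congˡ (≈-sym d)       τ = ≈-sym ([]-congˡ d τ)
  []-congˡ (≈-trans d e)   τ = ≈-trans ([]-congˡ d τ) ([]-congˡ e τ)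
  []-congˡ (≈-cong o ds)   τ = ≈-cong o λ i → []-congˡ (ds i) τ
  []-congˡ (≈-axiom e σ)   τ =
    []-assoc (lhs e) σ τ ∙ ≈-axiom e (λ x → σ x [ τ ]) ∙ ≈-sym ([]-assoc (rhs e) σ τ)

  ⟨,⟩-[] : {X : Set} (t : Term sig ℕ) → In12 ⊢ᵥ t → {a b : ℕ} (τ σ : ℕ → Term sig X) →
           𝕋 ⊢ τ a ≈ σ 1 → 𝕋 ⊢ τ b ≈ σ 2 → 𝕋 ⊢ t ⟨ a , b ⟩ [ τ ] ≈ t [ σ ]
  ⟨,⟩-[] t t-binary τ σ a≈ b≈ =
    []-assoc t _ τ ∙ []-congʳ t t-binary λ { _ (inj₁ refl) → a≈ ; _ (inj₂ refl) → b≈ }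

  rename-⟨,⟩ : (t : Term sig ℕ) → In12 ⊢ᵥ t → (h : ℕ → ℕ) {a b : ℕ} →
               𝕋 ⊢ rename h (t ⟨ a , b ⟩) ≈ t ⟨ h a , h b ⟩
  rename-⟨,⟩ t t-binary h {a} {b} =
    ⟨,⟩-[] t t-binary (var ∘ h) (pair (var (h a)) (var (h b))) ≈-refl ≈-refl

  ≈⟨1,2⟩ : (t : Term sig ℕ) → In12 ⊢ᵥ t → 𝕋 ⊢ t ≈ t ⟨ 1 , 2 ⟩
  ≈⟨1,2⟩ t t-binary =
    ≈-sym ([]-identity t) ∙ []-congʳ t t-binary λ { _ (inj₁ refl) → ≈-refl ; _ (inj₂ refl) → ≈-refl }

  diagonal : {X : Set} (t : Term sig ℕ) → In12 ⊢ᵥ t → 𝕋 ⊢ t ⟨ 1 , 1 ⟩ ≈ var 1 →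
             (σ : ℕ → Term sig X) {u : Term sig X} → (∀ x → In12 x → 𝕋 ⊢ σ x ≈ u) →
             𝕋 ⊢ t [ σ ] ≈ u
  diagonal t t-binary t-idem σ {u} σ≈u =
    []-congʳ t t-binary σ≈u ∙ ≈-sym (⟨,⟩-[] t t-binary (λ _ → u) (λ _ → u) ≈-refl ≈-refl)
    ∙ []-congˡ t-idem (λ _ → u)

  ⟨x,x⟩≈x : (t : Term sig ℕ) → In12 ⊢ᵥ t → 𝕋 ⊢ t ⟨ 1 , 1 ⟩ ≈ var 1 → (x : ℕ) →
            𝕋 ⊢ t ⟨ x , x ⟩ ≈ var x
  ⟨x,x⟩≈x t t-binary t-idem x =
    diagonal t t-binary t-idem _ λ { _ (inj₁ refl) → ≈-refl ; _ (inj₂ refl) → ≈-refl }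

  Only-≈-var : {y x : ℕ} (s : Term sig ℕ) → Only y ⊢ᵥ s → 𝕋 ⊢ s ≈ var x → 𝕋 ⊢ var x ≈ var y
  Only-≈-var {y} s s-only s≈x =
    ≈-sym s≈x ∙ ≈-sym ([]-identity s) ∙ []-congʳ s s-only (λ { _ refl → ≈-refl })
    ∙ []-congˡ s≈x (λ _ → var y)

module _ {Σ′ : Signature} {X : Set} (R : X → ℕ → Set) where
  open Signature Σ′

  data Relabels : Term Σ′ ℕ → Term Σ′ X → Set where
    leaf : ∀ {x m} → R x m → Relabels (var m) (var x)
    node : ∀ {o ss′ ss} → (∀ i → Relabels (ss′ i) (ss i)) → Relabels (op o ss′) (op o ss)

  relabels-rename : {A : ℕ → Set} (u : Term Σ′ ℕ) (h : ℕ → X) → A ⊢ᵥ u →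
                    (∀ {m} → A m → R (h m) m) → Relabels u (rename h u)
  relabels-rename (var m)   h a r = leaf (r a)
  relabels-rename (op o us) h a r = node λ i → relabels-rename (us i) h (a i) r

  relabels-[] : {A : ℕ → Set} (u : Term Σ′ ℕ) {σ′ : ℕ → Term Σ′ ℕ} {σ : ℕ → Term Σ′ X} →
                A ⊢ᵥ u → (∀ j → A j → Relabels (σ′ j) (σ j)) → Relabels (u [ σ′ ]) (u [ σ ])
  relabels-[] (var m)   a h = h m a
  relabels-[] (op o us) a h = node λ i → relabels-[] (us i) (a i) h

  ¬¬-relabels : (∀ x → ¬ ¬ Σ ℕ (R x)) → (s : Term Σ′ X) → ¬ ¬ Σ (Term Σ′ ℕ) (λ s′ → Relabels s′ s)
  ¬¬-relabels total (var x) = do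
    (m , r) ← total x
    pure (var m , leaf r)
  ¬¬-relabels total (op o ss) = do
    rs ← ¬¬-Π-Fin (arity o) λ i → ¬¬-relabels total (ss i)
    pure (op o (proj₁ ∘ rs) , node (proj₂ ∘ rs))

relabels-map : {Σ′ : Signature} {X Y : Set} {R : X → ℕ → Set} {R′ : Y → ℕ → Set}
               {h : X → Y} {π : ℕ → ℕ} → (∀ {x m} → R x m → R′ (h x) (π m)) →
               {s′ : Term Σ′ ℕ} {s : Term Σ′ X} →
               Relabels R s′ s → Relabels R′ (rename π s′) (rename h s)
relabels-map k (leaf r)  = leaf (k r)
relabels-map k (node rs) = node λ i → relabels-map k (rs i)

-- A derivation over X is replayed over ℕ: each intermediate term and each axiom instance is
-- relabelled afresh, and functionality of R makes any two relabellings provably equal.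
module Transfer (𝕋 : Theory) {X : Set} (R : X → ℕ → Set)
    (functional : ∀ {x m m′} → R x m → R x m′ → m ≡ m′)
    (total : ∀ x → ¬ ¬ Σ ℕ (R x)) where
  open Theory 𝕋 using (sig; lhs; rhs)
  open Equational 𝕋

  relabels-unique : {s′ s″ : Term sig ℕ} {s : Term sig X} →
                    Relabels R s′ s → Relabels R s″ s → 𝕋 ⊢ s′ ≈ s″
  relabels-unique (leaf r)  (leaf r′)  = ≡⇒≈ (cong var (functional r r′))
  relabels-unique (node rs) (node rs′) = ≈-cong _ λ i → relabels-unique (rs i) (rs′ i)

  ¬¬-transfer : {s t : Term sig X} → 𝕋 ⊢ s ≈ t → {s′ t′ : Term sig ℕ} →
                Relabels R s′ s → Relabels R t′ t → ¬ ¬ (𝕋 ⊢ s′ ≈ t′)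
  ¬¬-transfer ≈-refl rs rt = pure (relabels-unique rs rt)
  ¬¬-transfer (≈-sym d) rs rt = ≈-sym <$> ¬¬-transfer d rt rs
  ¬¬-transfer (≈-trans {t = u} d e) rs rt = do
    (u′ , ru) ← ¬¬-relabels R total u
    d′ ← ¬¬-transfer d rs ru
    e′ ← ¬¬-transfer e ru rt
    pure (d′ ∙ e′)
  ¬¬-transfer (≈-cong o ds) (node rs) (node rt) =
    ≈-cong o <$> ¬¬-Π-Fin _ λ i → ¬¬-transfer (ds i) (rs i) (rt i)
  ¬¬-transfer (≈-axiom e σ) rs rt with bounded (lhs e) | bounded (rhs e)
  ... | B₁ , lhs<B₁ | B₂ , rhs<B₂ = do
    (σ′ , σ′-ok) ← ¬¬-choice-< (B₁ ⊔ B₂) (var 0) λ j → ¬¬-relabels R total (σ j)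
    pure (relabels-unique rs (relabels-[] R (lhs e) lhs<B₁ λ j j< → σ′-ok j (≤-trans j< (m≤m⊔n B₁ B₂)))
          ∙ ≈-axiom e σ′
          ∙ relabels-unique (relabels-[] R (rhs e) rhs<B₂ λ j j< → σ′-ok j (≤-trans j< (m≤n⊔m B₁ B₂))) rt)

q-fmap⇒≈ : {𝕋 : Theory} {M : Monad} (pres : Presents 𝕋 M) {X Y : Set} (h : X → Y)
           (t : Term (Theory.sig 𝕋) X) {r : Term (Theory.sig 𝕋) Y} →
           Monad.fmap M h (Presents.q pres t) ≡ Presents.q pres r → 𝕋 ⊢ rename h t ≈ r
q-fmap⇒≈ pres h t e = Presents.q-complete pres (trans (sym (Presents.q-nat pres h t)) e)

[i+m*4]%4≡i : ∀ {i} m → i < 4 → (i + m * 4) % 4 ≡ i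
[i+m*4]%4≡i {i} m i<4 = trans ([m+kn]%n≡m%n i m 4) (m<n⇒m%n≡m i<4)

[i+m*4]/4≡m : ∀ {i} m → i < 4 → (i + m * 4) / 4 ≡ m
[i+m*4]/4≡m {i} m i<4 = trans (+-distrib-/-∣ʳ i (n∣m*n m)) (cong₂ _+_ (m<n⇒m/n≡0 i<4) (m*n/n≡m m 4))

glue glue-swap squash : ℕ → ℕ
glue 1 = 1
glue 2 = 2
glue 3 = 1
glue 4 = 2
glue _ = 3

glue-swap 1 = 1
glue-swap 2 = 2
glue-swap 3 = 2
glue-swap 4 = 1
glue-swap _ = 3

squash 1 = 1
squash 2 = 1
squash 3 = 2
squash 4 = 2
squash _ = 3

squash-glued : ℕ → ℕ → ℕ
squash-glued x y = if x ≡ᵇ y then 1 else 2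

squash-glued-binary : ∀ x y → In12 (squash-glued x y)
squash-glued-binary x y with x ≡ᵇ y
... | true  = inj₁ refl
... | false = inj₂ refl

squash-factors : ∀ w → In12 (glue w) → squash w ≡ squash-glued (glue w) (glue-swap w)
squash-factors 1 _ = refl
squash-factors 2 _ = refl
squash-factors 3 _ = refl
squash-factors 4 _ = refl
squash-factors 0 (inj₁ ())
squash-factors 0 (inj₂ ())
squash-factors (suc (suc (suc (suc (suc _))))) (inj₁ ())
squash-factors (suc (suc (suc (suc (suc _))))) (inj₂ ())

squash-label : ℕ → ℕ → ℕ → ℕ
squash-label 1 1 _ = 2
squash-label 1 2 _ = 2
squash-label 2 1 _ = 2
squash-label 2 2 _ = 2
squash-label _ _ k = k

squash-label-binary : ∀ {i j} k → In12 i → In12 j → squash-label i j k ≡ 2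
squash-label-binary k (inj₁ refl) (inj₁ refl) = refl
squash-label-binary k (inj₁ refl) (inj₂ refl) = refl
squash-label-binary k (inj₂ refl) (inj₁ refl) = refl
squash-label-binary k (inj₂ refl) (inj₂ refl) = refl

module BinaryNormalForms (ℙ : Theory) (consistent : Consistent ℙ)
    (Tℙ : Term (Theory.sig ℙ) ℕ → Set) (stable : Stable ℙ Tℙ) (universal : Universal ℙ Tℙ)
    (p : Term (Theory.sig ℙ) ℕ)
    (p-normal : (p′ : Term (Theory.sig ℙ) ℕ) → Tℙ p′ → ℙ ⊢ p ⟨ 1 , 2 ⟩ ≈ p′ → In12 ⊢ᵥ p′) where
  open Theory ℙ using (sig)
  open Equational ℙ

  normal-support : (t n : Term sig ℕ) → Tℙ n → ℙ ⊢ t ≈ n → (a : ℕ → ℕ) →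
                   ℙ ⊢ rename a t ≈ p ⟨ 1 , 2 ⟩ → (In12 ∘ a) ⊢ᵥ n
  normal-support t n n-normal t≈n a at≈p =
    ⊢ᵥ-rename⁻ n (p-normal (rename a n) (stable a n n-normal) (≈-sym at≈p ∙ []-congˡ t≈n (var ∘ a)))

  no-binary-collapse : (t : Term sig ℕ) (a a′ g : ℕ → ℕ) →
                       (∀ m → In12 (a m) → In12 (a′ m) → g m ≡ 2) →
                       ℙ ⊢ rename a t ≈ p ⟨ 1 , 2 ⟩ → ℙ ⊢ rename a′ t ≈ p ⟨ 1 , 2 ⟩ →
                       ℙ ⊢ rename g t ≈ var 1 → ⊥
  no-binary-collapse t a a′ g g≡2 at≈p a′t≈p gt≈1 with universal t
  ... | n , n-normal , t≈n with consistent 1 2 (Only-≈-var (rename g n) gn-only gn≈1)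
    where
    gn-only : Only 2 ⊢ᵥ rename g n
    gn-only = ⊢ᵥ-[] n (⊢ᵥ-× n (normal-support t n n-normal t≈n a at≈p)
                              (normal-support t n n-normal t≈n a′ a′t≈p))
                      λ m (am , a′m) → g≡2 m am a′m
    gn≈1 : ℙ ⊢ rename g n ≈ var 1
    gn≈1 = ≈-sym ([]-congˡ t≈n (var ∘ g)) ∙ gt≈1
  ... | ()

module Mixing (V : Monad) (𝕍 : Theory) (presV : Presents 𝕍 V)
    (T𝕍 : Term (Theory.sig 𝕍) ℕ → Set) (stable : Stable 𝕍 T𝕍) (universal : Universal 𝕍 T𝕍)
    (v : Term (Theory.sig 𝕍) ℕ) (v-binary : In12 ⊢ᵥ v) (v-idem : 𝕍 ⊢ v ⟨ 1 , 1 ⟩ ≈ var 1)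
    (var-normal : (v′ : Term (Theory.sig 𝕍) ℕ) (x : ℕ) → T𝕍 v′ → 𝕍 ⊢ var x ≈ v′ → Only x ⊢ᵥ v′)
    (v-normal : (v′ : Term (Theory.sig 𝕍) ℕ) → T𝕍 v′ → 𝕍 ⊢ v ⟨ 1 , 2 ⟩ ≈ v′ →
       ¬ (Only 1 ⊢ᵥ v′) × ¬ (Only 2 ⊢ᵥ v′)) where
  open Theory 𝕍 using (sig)
  open Monad V
  open Presents presV
  open Equational 𝕍

  v̂ : F ℕ
  v̂ = q v

  nf : F ℕ → Term sig ℕ
  nf b = proj₁ (universal (proj₁ (q-surj b)))

  nf-normal : (b : F ℕ) → T𝕍 (nf b)
  nf-normal b = proj₁ (proj₂ (universal (proj₁ (q-surj b))))

  q-nf : (b : F ℕ) → q (nf b) ≡ b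
  q-nf b = trans (sym (q-sound (proj₂ (proj₂ (universal (proj₁ (q-surj b))))))) (proj₂ (q-surj b))

  fmap-nf≈ : (h : ℕ → ℕ) (b : F ℕ) {r : Term sig ℕ} → fmap h b ≡ q r → 𝕍 ⊢ rename h (nf b) ≈ r
  fmap-nf≈ h b e = q-fmap⇒≈ presV h (nf b) (trans (cong (fmap h) (q-nf b)) e)

  η-support : (h : ℕ → ℕ) (b : F ℕ) {z : ℕ} → fmap h b ≡ η z → (λ w → h w ≡ z) ⊢ᵥ nf b
  η-support h b {z} e = ⊢ᵥ-rename⁻ (nf b)
    (var-normal (rename h (nf b)) z (stable h (nf b) (nf-normal b))
                (≈-sym (fmap-nf≈ h b (trans e (q-η z)))))

  η₁≢η₂ : η 1 ≢ η 2
  η₁≢η₂ e with universal (v ⟨ 1 , 2 ⟩)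
  ... | v′ , v′-normal , v≈v′ =
    proj₁ (v-normal v′ v′-normal v≈v′) (var-normal v′ 1 v′-normal (≈-sym v≈1 ∙ v≈v′))
    where
    1≈2 : 𝕍 ⊢ var 1 ≈ var 2
    1≈2 = q-complete (trans (sym (q-η 1)) (trans e (q-η 2)))
    v≈1 : 𝕍 ⊢ v ⟨ 1 , 2 ⟩ ≈ var 1
    v≈1 = diagonal v v-binary v-idem _ λ { _ (inj₁ refl) → ≈-refl ; _ (inj₂ refl) → ≈-sym 1≈2 }

  -- All variables of a normal form of b are glued to x and swap-glued to y, hence squashed to
  -- the single variable squash-glued x y; but v(1,2) is not equal to a term in one variable.
  squash-≢-v̂ : (b : F ℕ) {x y : ℕ} → In12 x → fmap glue b ≡ η x → fmap glue-swap b ≡ η y →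
               fmap squash b ≢ v̂
  squash-≢-v̂ b {x} {y} x-binary b-glue b-glue-swap b-squash =
    excluded (squash-glued-binary x y) squashed-only
    where
    squashed-only : Only (squash-glued x y) ⊢ᵥ rename squash (nf b)
    squashed-only =
      ⊢ᵥ-[] (nf b) (⊢ᵥ-× (nf b) (η-support glue b b-glue) (η-support glue-swap b b-glue-swap))
      λ { w (refl , refl) → squash-factors w x-binary }
    mixed : ¬ (Only 1 ⊢ᵥ rename squash (nf b)) × ¬ (Only 2 ⊢ᵥ rename squash (nf b))
    mixed = v-normal _ (stable squash (nf b) (nf-normal b))
                     (≈-sym (≈⟨1,2⟩ v v-binary) ∙ ≈-sym (fmap-nf≈ squash b b-squash))
    excluded : ∀ {c} → In12 c → ¬ (Only c ⊢ᵥ rename squash (nf b))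
    excluded (inj₁ refl) = proj₁ mixed
    excluded (inj₂ refl) = proj₂ mixed

  UnitLabel : F ℕ → ℕ → Set
  UnitLabel y m = (m ≡ 1 × y ≡ η 1) ⊎ (m ≡ 2 × y ≡ η 2) ⊎ (m ≡ 3 × y ≢ η 1 × y ≢ η 2)

  UnitLabel-functional : ∀ {y m m′} → UnitLabel y m → UnitLabel y m′ → m ≡ m′
  UnitLabel-functional (inj₁ (refl , _))              (inj₁ (refl , _))              = refl
  UnitLabel-functional (inj₁ (refl , y≡1))            (inj₂ (inj₁ (refl , y≡2)))     =
    ⊥-elim (η₁≢η₂ (trans (sym y≡1) y≡2))
  UnitLabel-functional (inj₁ (refl , y≡1))            (inj₂ (inj₂ (refl , y≢1 , _))) = ⊥-elim (y≢1 y≡1)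
  UnitLabel-functional (inj₂ (inj₁ (refl , y≡2)))     (inj₁ (refl , y≡1))            =
    ⊥-elim (η₁≢η₂ (trans (sym y≡1) y≡2))
  UnitLabel-functional (inj₂ (inj₁ (refl , _)))       (inj₂ (inj₁ (refl , _)))       = refl
  UnitLabel-functional (inj₂ (inj₁ (refl , y≡2)))     (inj₂ (inj₂ (refl , _ , y≢2))) = ⊥-elim (y≢2 y≡2)
  UnitLabel-functional (inj₂ (inj₂ (refl , y≢1 , _))) (inj₁ (refl , y≡1))            = ⊥-elim (y≢1 y≡1)
  UnitLabel-functional (inj₂ (inj₂ (refl , _ , y≢2))) (inj₂ (inj₁ (refl , y≡2)))     = ⊥-elim (y≢2 y≡2)
  UnitLabel-functional (inj₂ (inj₂ (refl , _)))       (inj₂ (inj₂ (refl , _)))       = refl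

  UnitLabel-total : ∀ y → ¬ ¬ Σ ℕ (UnitLabel y)
  UnitLabel-total y = do
    yes y≡1 ← ¬¬-excluded-middle
      where no y≢1 → do
        yes y≡2 ← ¬¬-excluded-middle
          where no y≢2 → pure (3 , inj₂ (inj₂ (refl , y≢1 , y≢2)))
        pure (2 , inj₂ (inj₁ (refl , y≡2)))
    pure (1 , inj₁ (refl , y≡1))

  UnitLabel-<4 : ∀ {y m} → UnitLabel y m → m < 4
  UnitLabel-<4 (inj₁ (refl , _))        = s≤s (s≤s z≤n)
  UnitLabel-<4 (inj₂ (inj₁ (refl , _))) = s≤s (s≤s (s≤s z≤n))
  UnitLabel-<4 (inj₂ (inj₂ (refl , _))) = s≤s (s≤s (s≤s (s≤s z≤n)))

  VLabel : F ℕ → ℕ → Set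
  VLabel y m = (m ≡ 1 × y ≡ v̂) ⊎ (m ≡ 2 × y ≢ v̂)

  VLabel-functional : ∀ {y m m′} → VLabel y m → VLabel y m′ → m ≡ m′
  VLabel-functional (inj₁ (refl , _))   (inj₁ (refl , _))   = refl
  VLabel-functional (inj₁ (refl , y≡v)) (inj₂ (refl , y≢v)) = ⊥-elim (y≢v y≡v)
  VLabel-functional (inj₂ (refl , y≢v)) (inj₁ (refl , y≡v)) = ⊥-elim (y≢v y≡v)
  VLabel-functional (inj₂ (refl , _))   (inj₂ (refl , _))   = refl

  VLabel-total : ∀ y → ¬ ¬ Σ ℕ (VLabel y)
  VLabel-total y = do
    yes y≡v ← ¬¬-excluded-middle
      where no y≢v → pure (2 , inj₂ (refl , y≢v))
    pure (1 , inj₁ (refl , y≡v))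

  VLabel-squash-label : ∀ {b i j k} → UnitLabel (fmap glue b) i → UnitLabel (fmap glue-swap b) j →
                        VLabel (fmap squash b) k → VLabel (fmap squash b) (squash-label i j k)
  VLabel-squash-label {b} (inj₁ (refl , g)) (inj₁ (refl , g′)) _ =
    inj₂ (refl , squash-≢-v̂ b (inj₁ refl) g g′)
  VLabel-squash-label {b} (inj₁ (refl , g)) (inj₂ (inj₁ (refl , g′))) _ =
    inj₂ (refl , squash-≢-v̂ b (inj₁ refl) g g′)
  VLabel-squash-label {b} (inj₂ (inj₁ (refl , g))) (inj₁ (refl , g′)) _ =
    inj₂ (refl , squash-≢-v̂ b (inj₂ refl) g g′)
  VLabel-squash-label {b} (inj₂ (inj₁ (refl , g))) (inj₂ (inj₁ (refl , g′))) _ =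
    inj₂ (refl , squash-≢-v̂ b (inj₂ refl) g g′)
  VLabel-squash-label (inj₁ (refl , _))        (inj₂ (inj₂ (refl , _))) r = r
  VLabel-squash-label (inj₂ (inj₁ (refl , _))) (inj₂ (inj₂ (refl , _))) r = r
  VLabel-squash-label (inj₂ (inj₂ (refl , _))) _                        r = r

  -- The three labels of b are packed into one variable i + (j + k * 4) * 4.
  Label : F ℕ → ℕ → Set
  Label b m = UnitLabel (fmap glue b) (m % 4) × UnitLabel (fmap glue-swap b) (m / 4 % 4) ×
              VLabel (fmap squash b) (m / 4 / 4)

  Label-total : ∀ b → ¬ ¬ Σ ℕ (Label b)
  Label-total b = do
    (i , ri) ← UnitLabel-total (fmap glue b)
    (j , rj) ← UnitLabel-total (fmap glue-swap b)
    (k , rk) ← VLabel-total (fmap squash b)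
    let i<4 = UnitLabel-<4 ri
        /4≡ = [i+m*4]/4≡m (j + k * 4) i<4
        j<4 = UnitLabel-<4 rj
    pure (i + (j + k * 4) * 4
         , subst (UnitLabel _) (sym ([i+m*4]%4≡i (j + k * 4) i<4)) ri
         , subst (UnitLabel _) (sym (trans (cong (_% 4) /4≡) ([i+m*4]%4≡i k j<4))) rj
         , subst (VLabel _) (sym (trans (cong (_/ 4) /4≡) ([i+m*4]/4≡m k j<4))) rk)

module NoDistributiveLaw (P V : Monad) (ℙ 𝕍 : Theory)
    (presP : Presents ℙ P) (presV : Presents 𝕍 V) (consistent : Consistent ℙ)
    (Tℙ : Term (Theory.sig ℙ) ℕ → Set) (stableℙ : Stable ℙ Tℙ) (universalℙ : Universal ℙ Tℙ)
    (T𝕍 : Term (Theory.sig 𝕍) ℕ → Set) (stable𝕍 : Stable 𝕍 T𝕍) (universal𝕍 : Universal 𝕍 T𝕍)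
    (p : Term (Theory.sig ℙ) ℕ) (p-binary : In12 ⊢ᵥ p)
    (v : Term (Theory.sig 𝕍) ℕ) (v-binary : In12 ⊢ᵥ v)
    (p-comm : ℙ ⊢ p ⟨ 1 , 2 ⟩ ≈ p ⟨ 2 , 1 ⟩)
    (p-idem : ℙ ⊢ p ⟨ 1 , 1 ⟩ ≈ var 1)
    (p-normal : (p′ : Term (Theory.sig ℙ) ℕ) → Tℙ p′ → ℙ ⊢ p ⟨ 1 , 2 ⟩ ≈ p′ → In12 ⊢ᵥ p′)
    (v-idem : 𝕍 ⊢ v ⟨ 1 , 1 ⟩ ≈ var 1)
    (var-normal : (v′ : Term (Theory.sig 𝕍) ℕ) (x : ℕ) → T𝕍 v′ → 𝕍 ⊢ var x ≈ v′ → Only x ⊢ᵥ v′)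
    (v-normal : (v′ : Term (Theory.sig 𝕍) ℕ) → T𝕍 v′ → 𝕍 ⊢ v ⟨ 1 , 2 ⟩ ≈ v′ →
       ¬ (Only 1 ⊢ᵥ v′) × ¬ (Only 2 ⊢ᵥ v′))
    (D : DistributiveLaw V P) where
  module PM = Monad P
  module VM = Monad V
  module PP = Presents presP
  module PV = Presents presV
  module ℙ = Equational ℙ
  module 𝕍 = Equational 𝕍
  open DistributiveLaw D using (λ′; natural; unitS; unitT)
  open Mixing V 𝕍 presV T𝕍 stable𝕍 universal𝕍 v v-binary v-idem var-normal v-normal
  open BinaryNormalForms ℙ consistent Tℙ stableℙ universalℙ p p-normal

  λv : (ℕ → PM.F ℕ) → PM.F (VM.F ℕ)
  λv σ = λ′ (PV.q (rename σ v))

  fmap-λv : (h : ℕ → ℕ) (σ : ℕ → PM.F ℕ) → PM.fmap (VM.fmap h) (λv σ) ≡ λv (PM.fmap h ∘ σ)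
  fmap-λv h σ = trans (natural h (PV.q (rename σ v)))
    (cong λ′ (trans (PV.q-nat (PM.fmap h) (rename σ v)) (PV.q-sound (𝕍.[]-assoc v _ _))))

  λv-const : (σ : ℕ → PM.F ℕ) {c : PM.F ℕ} → (∀ x → In12 x → σ x ≡ c) → λv σ ≡ PM.fmap VM.η c
  λv-const σ {c} σ≡c = trans (cong λ′ (trans (PV.q-sound v[σ]≈c) (sym (PV.q-η c)))) (unitS c)
    where
    v[σ]≈c : 𝕍 ⊢ rename σ v ≈ var c
    v[σ]≈c = 𝕍.diagonal v v-binary v-idem _ λ x x-binary → 𝕍.≡⇒≈ (cong var (σ≡c x x-binary))

  λv-η : (σ : ℕ → PM.F ℕ) → (∀ x → In12 x → σ x ≡ PM.η x) → λv σ ≡ PM.η v̂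
  λv-η σ σ≡η = trans (cong λ′ (trans (PV.q-sound v[σ]≈v[η]) (sym (PV.q-nat PM.η v)))) (unitT v̂)
    where
    v[σ]≈v[η] : 𝕍 ⊢ rename σ v ≈ rename PM.η v
    v[σ]≈v[η] = 𝕍.[]-congʳ v v-binary λ x x-binary → 𝕍.≡⇒≈ (cong var (σ≡η x x-binary))

  φ : ℕ → PM.F ℕ
  φ 2 = PP.q (p ⟨ 3 , 4 ⟩)
  φ _ = PP.q (p ⟨ 1 , 2 ⟩)

  glue-φ : ∀ x → In12 x → PM.fmap glue (φ x) ≡ PP.q (p ⟨ 1 , 2 ⟩)
  glue-φ _ (inj₁ refl) = trans (PP.q-nat glue _) (PP.q-sound (ℙ.rename-⟨,⟩ p p-binary glue))
  glue-φ _ (inj₂ refl) = trans (PP.q-nat glue _) (PP.q-sound (ℙ.rename-⟨,⟩ p p-binary glue))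

  glue-swap-φ : ∀ x → In12 x → PM.fmap glue-swap (φ x) ≡ PP.q (p ⟨ 1 , 2 ⟩)
  glue-swap-φ _ (inj₁ refl) = trans (PP.q-nat glue-swap _)
    (PP.q-sound (ℙ.rename-⟨,⟩ p p-binary glue-swap))
  glue-swap-φ _ (inj₂ refl) = trans (PP.q-nat glue-swap _)
    (PP.q-sound (ℙ.rename-⟨,⟩ p p-binary glue-swap ℙ.∙ ≈-sym p-comm))

  squash-φ : ∀ x → In12 x → PM.fmap squash (φ x) ≡ PM.η x
  squash-φ _ (inj₁ refl) = trans (PP.q-nat squash _)
    (trans (PP.q-sound (ℙ.rename-⟨,⟩ p p-binary squash ℙ.∙ p-idem)) (sym (PP.q-η 1)))
  squash-φ _ (inj₂ refl) = trans (PP.q-nat squash _)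
    (trans (PP.q-sound (ℙ.rename-⟨,⟩ p p-binary squash ℙ.∙ ℙ.⟨x,x⟩≈x p p-binary p-idem 2))
           (sym (PP.q-η 2)))

  T : Term (Theory.sig ℙ) (VM.F ℕ)
  T = proj₁ (PP.q-surj (λv φ))

  T-fmap≈ : (h : ℕ → ℕ) {r : Term (Theory.sig ℙ) (VM.F ℕ)} →
            PM.fmap (VM.fmap h) (λv φ) ≡ PP.q r → ℙ ⊢ rename (VM.fmap h) T ≈ r
  T-fmap≈ h e =
    q-fmap⇒≈ presP (VM.fmap h) T (trans (cong (PM.fmap (VM.fmap h)) (proj₂ (PP.q-surj (λv φ)))) e)

  T-glued : (h : ℕ → ℕ) → (∀ x → In12 x → PM.fmap h (φ x) ≡ PP.q (p ⟨ 1 , 2 ⟩)) →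
            ℙ ⊢ rename (VM.fmap h) T ≈ rename VM.η (p ⟨ 1 , 2 ⟩)
  T-glued h hφ = T-fmap≈ h (trans (fmap-λv h φ) (trans (λv-const _ hφ) (PP.q-nat VM.η _)))

  T-squashed : ℙ ⊢ rename (VM.fmap squash) T ≈ var v̂
  T-squashed = T-fmap≈ squash (trans (fmap-λv squash φ) (trans (λv-η _ squash-φ) (PP.q-η v̂)))

  η-relabels : Relabels UnitLabel (p ⟨ 1 , 2 ⟩) (rename VM.η (p ⟨ 1 , 2 ⟩))
  η-relabels = relabels-rename UnitLabel (p ⟨ 1 , 2 ⟩) VM.η (⊢ᵥ-⟨1,2⟩ p p-binary)
    λ { (inj₁ refl) → inj₁ (refl , refl) ; (inj₂ refl) → inj₂ (inj₁ (refl , refl)) }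

  open Transfer ℙ UnitLabel UnitLabel-functional UnitLabel-total renaming (¬¬-transfer to ¬¬-transferᵤ)
  open Transfer ℙ VLabel VLabel-functional VLabel-total renaming (¬¬-transfer to ¬¬-transferᵥ)

  ¬¬⊥ : ¬ ¬ ⊥
  ¬¬⊥ = do
    (T₀ , T₀-relabels) ← ¬¬-relabels Label Label-total T
    glued ← ¬¬-transferᵤ (T-glued glue glue-φ) (relabels-map proj₁ T₀-relabels) η-relabels
    swap-glued ← ¬¬-transferᵤ (T-glued glue-swap glue-swap-φ)
                   (relabels-map (proj₁ ∘ proj₂) T₀-relabels) η-relabels
    squashed ← ¬¬-transferᵥ T-squashed
                 (relabels-map (λ (ri , rj , rk) → VLabel-squash-label ri rj rk) T₀-relabels)
                 (leaf (inj₁ (refl , refl)))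
    pure (no-binary-collapse T₀ (_% 4) (λ m → m / 4 % 4)
            (λ m → squash-label (m % 4) (m / 4 % 4) (m / 4 / 4))
            (λ m → squash-label-binary (m / 4 / 4)) glued swap-glued squashed)

corollary3p8 : (P V : Monad) (ℙ 𝕍 : Theory) →
    Presents ℙ P → Presents 𝕍 V → Consistent ℙ →
    (Tℙ : Term (Theory.sig ℙ) ℕ → Set) → Stable ℙ Tℙ → Universal ℙ Tℙ →
    (T𝕍 : Term (Theory.sig 𝕍) ℕ → Set) → Stable 𝕍 T𝕍 → Universal 𝕍 T𝕍 →
    (p : Term (Theory.sig ℙ) ℕ) → In12 ⊢ᵥ p →
    (v : Term (Theory.sig 𝕍) ℕ) → In12 ⊢ᵥ v →
    ℙ ⊢ p ⟨ 1 , 2 ⟩ ≈ p ⟨ 2 , 1 ⟩ →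
    ℙ ⊢ p ⟨ 1 , 1 ⟩ ≈ var 1 →
    ((p′ : Term (Theory.sig ℙ) ℕ) → Tℙ p′ → ℙ ⊢ p ⟨ 1 , 2 ⟩ ≈ p′ → In12 ⊢ᵥ p′) →
    𝕍 ⊢ v ⟨ 1 , 1 ⟩ ≈ var 1 →
    ((v′ : Term (Theory.sig 𝕍) ℕ) (x : ℕ) → T𝕍 v′ → 𝕍 ⊢ var x ≈ v′ → Only x ⊢ᵥ v′) →
    ((v′ : Term (Theory.sig 𝕍) ℕ) → T𝕍 v′ → 𝕍 ⊢ v ⟨ 1 , 2 ⟩ ≈ v′ →
       ¬ (Only 1 ⊢ᵥ v′) × ¬ (Only 2 ⊢ᵥ v′)) →
    ¬ DistributiveLaw V P
corollary3p8 P V ℙ 𝕍 presP presV consistent Tℙ stableℙ universalℙ T𝕍 stable𝕍 universal𝕍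
             p p-binary v v-binary p-comm p-idem p-normal v-idem var-normal v-normal D =
  NoDistributiveLaw.¬¬⊥ P V ℙ 𝕍 presP presV consistent Tℙ stableℙ universalℙ T𝕍 stable𝕍 universal𝕍
                    p p-binary v v-binary p-comm p-idem p-normal v-idem var-normal v-normal D id
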